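{- Let $F=\begin{bmatrix}0&1\\0&1\end{bmatrix}$. Then $\mathrm{sat}(n,F)=3$ for every $n\ge 2$.
   Context: All matrices are $0$-$1$ matrices. A matrix is simple if it has no repeated columns. A matrix $F$ is a submatrix of $A$ if, after deleting some rows and columns of $A$, one obtains a row and column permutation of $F$. A simple $n$-row matrix $M$ is $F$-saturated if it does not contain $F$ as a submatrix but appending any $n$-column not already a column of $M$ produces a matrix containing $F$; $\mathrm{sat}(n,F)$ is the minimum number of columns of an $F$-saturated $n$-row matrix. -}

module Defs where

open import Data.Bool using (Bool; true; false)
open import Data.Nat using (ℕ; suc; _≤_)
open import Data.Fin using (Fin)
open import Data.Vec using (Vec; []; _∷_; lookup; _∷ʳ_)
open import Data.Vec.Membership.Propositional using (_∈_)
open import Data.Product using (Σ; ∃; _×_)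
open import Relation.Binary.PropositionalEquality using (_≡_)
open import Relation.Nullary using (¬_)
open import Function.Definitions using (Injective)

-- A 0-1 matrix with n rows and m columns, stored as a vector of its m columns
-- (each column a vector of n bits).
Mat : ℕ → ℕ → Set
Mat n m = Vec (Vec Bool n) m

entry : ∀ {n m} → Mat n m → Fin n → Fin m → Bool
entry A i j = lookup (lookup A j) i

Simple : ∀ {n m} → Mat n m → Set
Simple A = Injective _≡_ _≡_ (lookup A)

-- F (k × l) is a submatrix of A (n × m): there are injective choices of
-- k rows and l columns of A (in any order, which accounts for the row and
-- column permutations) on which A agrees with F.
_⊑_ : ∀ {k l n m} → Mat k l → Mat n m → Set
_⊑_ {k} {l} {n} {m} F A =
  Σ (Fin k → Fin n) λ ρ → Σ (Fin l → Fin m) λ γ →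
    Injective _≡_ _≡_ ρ × Injective _≡_ _≡_ γ ×
    (∀ i j → entry F i j ≡ entry A (ρ i) (γ j))

Saturated : ∀ {k l n m} → Mat k l → Mat n m → Set
Saturated {n = n} F M =
  Simple M × ¬ (F ⊑ M) ×
  (∀ (c : Vec Bool n) → ¬ (c ∈ M) → F ⊑ (M ∷ʳ c))

SatEq : ∀ {k l} → ℕ → Mat k l → ℕ → Set
SatEq n F s =
  Σ (Mat n s) (λ M → Saturated F M) ×
  (∀ m (M : Mat n m) → Saturated F M → s ≤ m)

-- F = [0 1; 0 1], given by its columns (0,0) and (1,1)
F₀₁ : Mat 2 2
F₀₁ = (false ∷ false ∷ []) ∷ (true ∷ true ∷ []) ∷ []

-- Two columns x, y (in this order) of a matrix carry a copy of F exactly when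
-- there are two distinct rows on which x reads 0 and y reads 1 (FormsF x y);
-- so a matrix contains F iff two of its distinct columns form F.  Call x and
-- y compatible when they form F in neither order.  Two facts produce
-- compatible pairs:
--   * if x, y agree outside rows {r, s} and x takes different values on r and
--     s (or r = s), they are compatible (compatible-offPair);
--   * replacing x by x' is harmless if x' agrees with x wherever x' differs
--     from y (compatible-transport).
-- Upper bound: the columns e₁, e₂, e₁+e₂ (supported on the two top rows) are
-- pairwise compatible, and every new column creates F with one of them.
-- Lower bound: an F-free simple matrix with at most two columns always admits
-- a new column compatible with all its columns — a copy of a column with one
-- row flipped, or, if that copy is the other column, a copy rewritten on two
-- rows — so it is not saturated.
module Submission where

open import Defs
open import Data.Nat using (ℕ; _≤_; suc; zero; s≤s; z≤n)
open import Data.Bool using (Bool; true; false; not)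
import Data.Bool.Properties as Bool
open import Data.Fin using (Fin; zero; suc; punchIn)
import Data.Fin.Properties as Fin
open import Data.Vec using (Vec; []; _∷_; _∷ʳ_; lookup; replicate; _[_]≔_)
open import Data.Vec.Properties using (lookup-replicate; lookup∘update; lookup∘update′; ≡-dec)
open import Data.Vec.Membership.Propositional using (_∈_)
open import Data.Vec.Relation.Unary.Any using (here; there)
open import Data.Product using (Σ; _×_; _,_; swap)
open import Data.Sum using (_⊎_; inj₁; inj₂)
open import Data.Empty using (⊥; ⊥-elim)
open import Relation.Nullary using (¬_; yes; no)
open import Relation.Binary.PropositionalEquality using (_≡_; _≢_; refl; sym; trans; cong; ≢-sym)
open import Function using (_∘_)

FormsF : ∀ {n} → Vec Bool n → Vec Bool n → Set
FormsF {n} x y = Σ (Fin n) λ p → Σ (Fin n) λ q → p ≢ q ×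
  lookup x p ≡ false × lookup x q ≡ false × lookup y p ≡ true × lookup y q ≡ true

Compatible : ∀ {n} → Vec Bool n → Vec Bool n → Set
Compatible x y = ¬ FormsF x y × ¬ FormsF y x

false≢true : ∀ {a b : Bool} → a ≡ false → b ≡ true → a ≢ b
false≢true refl refl ()

0≢1 : _≡_ {A = Fin 2} zero (suc zero) → ⊥
0≢1 ()

⊑⇒formsF : ∀ {n m} (A : Mat n m) → F₀₁ ⊑ A →
  Σ (Fin m) λ j → Σ (Fin m) λ k → j ≢ k × FormsF (lookup A j) (lookup A k)
⊑⇒formsF A (ρ , γ , ρ-inj , γ-inj , agree) =
  γ zero , γ (suc zero) , (λ eq → 0≢1 (γ-inj eq)) ,
  ρ zero , ρ (suc zero) , (λ eq → 0≢1 (ρ-inj eq)) ,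
  sym (agree zero zero) , sym (agree (suc zero) zero) ,
  sym (agree zero (suc zero)) , sym (agree (suc zero) (suc zero))

formsF⇒⊑ : ∀ {n m} (A : Mat n m) (j k : Fin m) → j ≢ k →
  FormsF (lookup A j) (lookup A k) → F₀₁ ⊑ A
formsF⇒⊑ A j k j≢k (p , q , p≢q , xp , xq , yp , yq) = pick p q , pick j k , inj p≢q , inj j≢k , agree
  where
  pick : ∀ {N} → Fin N → Fin N → Fin 2 → Fin N
  pick a b zero    = a
  pick a b (suc _) = b

  inj : ∀ {N} {a b : Fin N} → a ≢ b → ∀ {u v} → pick a b u ≡ pick a b v → u ≡ v
  inj a≢b {zero}     {zero}     _  = refl
  inj a≢b {zero}     {suc zero} eq = ⊥-elim (a≢b eq)
  inj a≢b {suc zero} {zero}     eq = ⊥-elim (a≢b (sym eq))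
  inj a≢b {suc zero} {suc zero} _  = refl

  agree : ∀ i l → entry F₀₁ i l ≡ entry A (pick p q i) (pick j k l)
  agree zero       zero       = sym xp
  agree zero       (suc zero) = sym yp
  agree (suc zero) zero       = sym xq
  agree (suc zero) (suc zero) = sym yq

F-free₁ : ∀ {n} (a : Vec Bool n) → ¬ (F₀₁ ⊑ (a ∷ []))
F-free₁ a sub with ⊑⇒formsF (a ∷ []) sub
... | zero , zero , j≢k , _ = j≢k refl

F-free₂ : ∀ {n} (a b : Vec Bool n) → Compatible a b → ¬ (F₀₁ ⊑ (a ∷ b ∷ []))
F-free₂ a b (ab , ba) sub with ⊑⇒formsF (a ∷ b ∷ []) sub
... | zero     , zero     , j≢k , _ = j≢k refl
... | zero     , suc zero , _   , f = ab f
... | suc zero , zero     , _   , f = ba f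
... | suc zero , suc zero , j≢k , _ = j≢k refl

F-free₃ : ∀ {n} (a b c : Vec Bool n) →
  Compatible a b → Compatible a c → Compatible b c → ¬ (F₀₁ ⊑ (a ∷ b ∷ c ∷ []))
F-free₃ a b c (ab , ba) (ac , ca) (bc , cb) sub with ⊑⇒formsF (a ∷ b ∷ c ∷ []) sub
... | zero           , zero           , j≢k , _ = j≢k refl
... | zero           , suc zero       , _   , f = ab f
... | zero           , suc (suc zero) , _   , f = ac f
... | suc zero       , zero           , _   , f = ba f
... | suc zero       , suc zero       , j≢k , _ = j≢k refl
... | suc zero       , suc (suc zero) , _   , f = bc f
... | suc (suc zero) , zero           , _   , f = ca f
... | suc (suc zero) , suc zero       , _   , f = cb f
... | suc (suc zero) , suc (suc zero) , j≢k , _ = j≢k refl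

SplitRows : ∀ {n} → Vec Bool n → Vec Bool n → Set
SplitRows {n} x y = Σ (Fin n) λ p → Σ (Fin n) λ q → p ≢ q ×
  lookup x p ≢ lookup y p × lookup x q ≢ lookup y q × lookup x p ≡ lookup x q

splitRows : ∀ {n} (x y : Vec Bool n) → FormsF x y ⊎ FormsF y x → SplitRows x y
splitRows x y (inj₁ (p , q , p≢q , xp , xq , yp , yq)) =
  p , q , p≢q , false≢true xp yp , false≢true xq yq , trans xp (sym xq)
splitRows x y (inj₂ (p , q , p≢q , yp , yq , xp , xq)) =
  p , q , p≢q , ≢-sym (false≢true yp xp) , ≢-sym (false≢true yq xq) , trans xp (sym xq)

compatible-offPair : ∀ {n} (x y : Vec Bool n) (r s : Fin n) →
  (∀ t → t ≢ r → t ≢ s → lookup x t ≡ lookup y t) →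
  (lookup x r ≡ lookup x s → r ≡ s) → Compatible x y
compatible-offPair x y r s agree separates =
  (λ f → excluded (splitRows x y (inj₁ f))) , (λ f → excluded (splitRows x y (inj₂ f)))
  where
  onPair : ∀ t → lookup x t ≢ lookup y t → t ≡ r ⊎ t ≡ s
  onPair t x≢y with t Fin.≟ r | t Fin.≟ s
  ... | yes t≡r | _       = inj₁ t≡r
  ... | no _    | yes t≡s = inj₂ t≡s
  ... | no t≢r  | no t≢s  = ⊥-elim (x≢y (agree t t≢r t≢s))

  sameRow : ∀ {p q} → p ≡ r ⊎ p ≡ s → q ≡ r ⊎ q ≡ s → lookup x p ≡ lookup x q → p ≡ q
  sameRow (inj₁ refl) (inj₁ refl) _ = refl
  sameRow (inj₁ refl) (inj₂ refl) e = separates e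
  sameRow (inj₂ refl) (inj₁ refl) e = sym (separates (sym e))
  sameRow (inj₂ refl) (inj₂ refl) _ = refl

  excluded : ¬ SplitRows x y
  excluded (p , q , p≢q , dp , dq , e) = p≢q (sameRow (onPair p dp) (onPair q dq) e)

compatible-transport : ∀ {n} (x x' y : Vec Bool n) →
  (∀ t → lookup x' t ≢ lookup y t → lookup x' t ≡ lookup x t) →
  Compatible x y → Compatible x' y
compatible-transport x x' y keep (xy , yx) = x'y , yx'
  where
  x'y : ¬ FormsF x' y
  x'y (p , q , p≢q , xp , xq , yp , yq) =
    xy (p , q , p≢q , trans (sym (keep p (false≢true xp yp))) xp ,
                      trans (sym (keep q (false≢true xq yq))) xq , yp , yq)
  yx' : ¬ FormsF y x'
  yx' (p , q , p≢q , yp , yq , xp , xq) =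
    yx (p , q , p≢q , yp , yq ,
        trans (sym (keep p (≢-sym (false≢true yp xp)))) xp ,
        trans (sym (keep q (≢-sym (false≢true yq xq)))) xq)

differAt : ∀ {n} {x y : Vec Bool n} (t : Fin n) → lookup x t ≢ lookup y t → x ≢ y
differAt t x≢y refl = x≢y refl

differingRow : ∀ {n} (x y : Vec Bool n) → x ≢ y → Σ (Fin n) λ r → lookup x r ≢ lookup y r
differingRow []       []       x≢y = ⊥-elim (x≢y refl)
differingRow (a ∷ xs) (b ∷ ys) x≢y with a Bool.≟ b
... | no a≢b = zero , a≢b
... | yes refl with differingRow xs ys (λ eq → x≢y (cong (a ∷_) eq))
... | r , ne = suc r , ne

not≢ : ∀ b → not b ≢ b
not≢ false ()
not≢ true ()

≢⇒not : ∀ {a b : Bool} → a ≢ b → not a ≡ b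
≢⇒not {false} {false} h = ⊥-elim (h refl)
≢⇒not {false} {true}  _ = refl
≢⇒not {true}  {false} _ = refl
≢⇒not {true}  {true}  h = ⊥-elim (h refl)

∉-single : ∀ {n} {c a : Vec Bool n} → c ≢ a → ¬ (c ∈ a ∷ [])
∉-single c≢a (here eq) = c≢a eq

∉-pair : ∀ {n} {c a b : Vec Bool n} → c ≢ a → c ≢ b → ¬ (c ∈ a ∷ b ∷ [])
∉-pair c≢a c≢b (here eq)         = c≢a eq
∉-pair c≢a c≢b (there (here eq)) = c≢b eq

flip : ∀ {n} → Vec Bool n → Fin n → Vec Bool n
flip d r = d [ r ]≔ not (lookup d r)

flip-at : ∀ {n} (d : Vec Bool n) r → lookup (flip d r) r ≡ not (lookup d r)
flip-at d r = lookup∘update r d (not (lookup d r))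

flip-off : ∀ {n} (d : Vec Bool n) r t → t ≢ r → lookup (flip d r) t ≡ lookup d t
flip-off d r t t≢r = lookup∘update′ t≢r d (not (lookup d r))

flip-new : ∀ {n} (d : Vec Bool n) r → flip d r ≢ d
flip-new d r = differAt r λ e → not≢ (lookup d r) (trans (sym (flip-at d r)) e)

flip-compatible : ∀ {n} (d : Vec Bool n) r → Compatible (flip d r) d
flip-compatible d r =
  compatible-offPair (flip d r) d r r (λ t t≢r _ → flip-off d r t t≢r) (λ _ → refl)

-- The column agreeing with d except that row r copies row s and row s is
-- negated; since it separates r from s it is compatible with d.
shift : ∀ {n} → Vec Bool n → Fin n → Fin n → Vec Bool n
shift d r s = (d [ r ]≔ lookup d s) [ s ]≔ not (lookup d s)

module _ {n} (d : Vec Bool n) {r s : Fin n} (r≢s : r ≢ s) where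

  private
    copied : Vec Bool n
    copied = d [ r ]≔ lookup d s

  shift-at-s : lookup (shift d r s) s ≡ not (lookup d s)
  shift-at-s = lookup∘update s copied (not (lookup d s))

  shift-at-r : lookup (shift d r s) r ≡ lookup d s
  shift-at-r = trans (lookup∘update′ r≢s copied (not (lookup d s)))
                     (lookup∘update r d (lookup d s))

  shift-off : ∀ t → t ≢ r → t ≢ s → lookup (shift d r s) t ≡ lookup d t
  shift-off t t≢r t≢s = trans (lookup∘update′ t≢s copied (not (lookup d s)))
                              (lookup∘update′ t≢r d (lookup d s))

  shift-separates : lookup (shift d r s) r ≡ lookup (shift d r s) s → r ≡ s
  shift-separates e =
    ⊥-elim (not≢ (lookup d s) (sym (trans (sym shift-at-r) (trans e shift-at-s))))

no-sat₀ : ∀ {n} (M : Mat n 0) → ¬ Saturated F₀₁ M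
no-sat₀ {n} [] (_ , _ , saturated) = F-free₁ c (saturated c λ ())
  where
  c = replicate n false

no-sat₁ : ∀ {k} (M : Mat (suc k) 1) → ¬ Saturated F₀₁ M
no-sat₁ (d ∷ []) (_ , _ , saturated) =
  F-free₂ d c (swap (flip-compatible d zero)) (saturated c (∉-single (flip-new d zero)))
  where
  c = flip d zero

-- ... and at least three: for distinct compatible columns d₁, d₂ differing in
-- row r, flip d₁ r is compatible with both unless it equals d₂; in that case
-- d₂ is d₁ flipped at r and shift d₁ r s (any s ≠ r) is compatible with both.
no-sat₂ : ∀ {k} (M : Mat (suc (suc k)) 2) → ¬ Saturated F₀₁ M
no-sat₂ (d₁ ∷ d₂ ∷ []) (simple , free , saturated)
  with differingRow d₁ d₂ (λ eq → 0≢1 (simple eq))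
... | r , d₁≢d₂ with ≡-dec Bool._≟_ (flip d₁ r) d₂
... | no c≢d₂ =
  F-free₃ d₁ d₂ c compatible₁₂ (swap (flip-compatible d₁ r))
          (swap (compatible-transport d₁ c d₂ keep compatible₁₂))
          (saturated c (∉-pair (flip-new d₁ r) c≢d₂))
  where
  c = flip d₁ r
  compatible₁₂ : Compatible d₁ d₂
  compatible₁₂ = (λ f → free (formsF⇒⊑ (d₁ ∷ d₂ ∷ []) zero (suc zero) (λ ()) f)) ,
                 (λ f → free (formsF⇒⊑ (d₁ ∷ d₂ ∷ []) (suc zero) zero (λ ()) f))
  keep : ∀ t → lookup c t ≢ lookup d₂ t → lookup c t ≡ lookup d₁ t
  keep t c≢d₂ with t Fin.≟ r
  ... | yes refl = ⊥-elim (c≢d₂ (trans (flip-at d₁ r) (≢⇒not d₁≢d₂)))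
  ... | no t≢r   = flip-off d₁ r t t≢r
... | yes refl =
  F-free₃ d₁ (flip d₁ r) c (swap (flip-compatible d₁ r))
          (swap (compatible-offPair c d₁ r s (shift-off d₁ r≢s) (shift-separates d₁ r≢s)))
          (swap (compatible-offPair c (flip d₁ r) r s off₂ (shift-separates d₁ r≢s)))
          (saturated c (∉-pair (differAt s at₁) (differAt s at₂)))
  where
  s = punchIn r zero
  s≢r : s ≢ r
  s≢r = Fin.punchInᵢ≢i r zero
  r≢s : r ≢ s
  r≢s e = s≢r (sym e)
  c = shift d₁ r s
  at₁ : lookup c s ≢ lookup d₁ s
  at₁ e = not≢ (lookup d₁ s) (trans (sym (shift-at-s d₁ r≢s)) e)
  at₂ : lookup c s ≢ lookup (flip d₁ r) s
  at₂ e = at₁ (trans e (flip-off d₁ r s s≢r))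
  off₂ : ∀ t → t ≢ r → t ≢ s → lookup c t ≡ lookup (flip d₁ r) t
  off₂ t t≢r t≢s = trans (shift-off d₁ r≢s t t≢r t≢s) (sym (flip-off d₁ r t t≢r))

sat-lower : ∀ {k} m (M : Mat (suc (suc k)) m) → Saturated F₀₁ M → 3 ≤ m
sat-lower zero                M sat = ⊥-elim (no-sat₀ M sat)
sat-lower (suc zero)          M sat = ⊥-elim (no-sat₁ M sat)
sat-lower (suc (suc zero))    M sat = ⊥-elim (no-sat₂ M sat)
sat-lower (suc (suc (suc m))) M _   = s≤s (s≤s (s≤s z≤n))

someTrue : ∀ {k} (w : Vec Bool k) → w ≢ replicate k false → Σ (Fin k) λ t → lookup w t ≡ true
someTrue []          w≢0 = ⊥-elim (w≢0 refl)
someTrue (true ∷ w)  _   = zero , refl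
someTrue (false ∷ w) w≢0 with someTrue w (λ eq → w≢0 (cong (false ∷_) eq))
... | t , wt = suc t , wt

module Witness (k : ℕ) where

  zeros : Vec Bool k
  zeros = replicate k false

  top : Bool → Bool → Vec Bool (suc (suc k))
  top a b = a ∷ b ∷ zeros

  M : Mat (suc (suc k)) 3
  M = top true false ∷ top false true ∷ top true true ∷ []

  simple : Simple M
  simple {zero}           {zero}           _ = refl
  simple {zero}           {suc zero}       ()
  simple {zero}           {suc (suc zero)} ()
  simple {suc zero}       {zero}           ()
  simple {suc zero}       {suc zero}       _ = refl
  simple {suc zero}       {suc (suc zero)} ()
  simple {suc (suc zero)} {zero}           ()
  simple {suc (suc zero)} {suc zero}       ()
  simple {suc (suc zero)} {suc (suc zero)} _ = refl

  -- Columns of M agree below the top two rows, so a pair is compatible as soon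
  -- as its first column reads differently on the two top rows.
  compatible-top : ∀ a b a' b' → a ≢ b → Compatible (top a b) (top a' b')
  compatible-top a b a' b' a≢b =
    compatible-offPair (top a b) (top a' b') zero (suc zero) below (λ e → ⊥-elim (a≢b e))
    where
    below : ∀ t → t ≢ zero → t ≢ suc zero → lookup (top a b) t ≡ lookup (top a' b') t
    below zero          t≢0 _   = ⊥-elim (t≢0 refl)
    below (suc zero)    _   t≢1 = ⊥-elim (t≢1 refl)
    below (suc (suc t)) _   _   = refl

  free : ¬ (F₀₁ ⊑ M)
  free = F-free₃ _ _ _ (compatible-top true false false true λ ())
                       (compatible-top true false true true λ ())
                       (compatible-top false true true true λ ())

  belowTop : ∀ {a b} (w : Vec Bool k) → a ∷ b ∷ w ≢ top a b → Σ (Fin k) λ t → lookup w t ≡ true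
  belowTop {a} {b} w ne = someTrue w (ne ∘ cong (λ v → a ∷ b ∷ v))

  -- A new column c creates F with e₁ + e₂ if its top is 00; otherwise it has a
  -- 1 below the top (else it would be a column of M), and forms F with e₂
  -- (top 1•) or e₁ (top 01) using that row and the top row where it reads 1.
  saturated : ∀ (c : Vec Bool (suc (suc k))) → ¬ (c ∈ M) → F₀₁ ⊑ (M ∷ʳ c)
  saturated (false ∷ false ∷ w) _ =
    formsF⇒⊑ (M ∷ʳ _) (suc (suc (suc zero))) (suc (suc zero)) (λ ())
             (zero , suc zero , (λ ()) , refl , refl , refl , refl)
  saturated (true ∷ false ∷ w) c∉M with belowTop w (c∉M ∘ here)
  ... | t , wt = formsF⇒⊑ (M ∷ʳ _) (suc zero) (suc (suc (suc zero))) (λ ())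
                         (zero , suc (suc t) , (λ ()) , refl , lookup-replicate t false , refl , wt)
  saturated (true ∷ true ∷ w) c∉M with belowTop w (c∉M ∘ there ∘ there ∘ here)
  ... | t , wt = formsF⇒⊑ (M ∷ʳ _) (suc zero) (suc (suc (suc zero))) (λ ())
                         (zero , suc (suc t) , (λ ()) , refl , lookup-replicate t false , refl , wt)
  saturated (false ∷ true ∷ w) c∉M with belowTop w (c∉M ∘ there ∘ here)
  ... | t , wt = formsF⇒⊑ (M ∷ʳ _) zero (suc (suc (suc zero))) (λ ())
                         (suc zero , suc (suc t) , (λ ()) , refl , lookup-replicate t false , refl , wt)

mainTheorem10 : ∀ (n : ℕ) → 2 ≤ n → SatEq n F₀₁ 3
mainTheorem10 (suc (suc k)) (s≤s (s≤s z≤n)) =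
  (M , simple , free , saturated) , sat-lower
  where open Witness k
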